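{- Let $X=(x_i,y_{il})$ be a solution returned by the LP relaxation (an optimal extreme-point solution) which is an $\mathcal{X}$-solution, i.e. the vector $(x_i)_{t_i\in I_C}$ is an extreme point of the polytope $P=\{x\in[0,1]^{I_C}: x_i+x_l\le 1 \text{ for all } (t_i,t_l)\not\models\Sigma\}$. Then every $x_i$ and every $y_{il}$ in $X$ lies in $\{0,\tfrac12,1\}$.
   Context: Let $I$ be a relation instance with a set $\Sigma$ of denial constraints; $(t_i,t_l)\not\models\Sigma$ means the pair of tuples violates some constraint, and $I_C=\{t_i:\exists t_l\in I,(t_i,t_l)\not\models\Sigma\}$. Real weights $L(t_i,t_l)$ and an integer $k\ge1$ are given. For $t_i\in I$, let $t_{l^*}$ be the tuple of $(I\setminus I_C)\setminus\{t_i\}$ with the $k$-th largest value $L(t_i,\cdot)$ among such tuples, and $\overline{M}(t_i)=\{t_r\in I\setminus\{t_i\}:L(t_i,t_r)\ge L(t_i,t_{l^*})\}$. The LP relaxation is: maximize $\sum_{t_i\in I}\sum_{t_l\in\overline{M}(t_i)}y_{il}L(t_i,t_l)$ subject to $x_i+x_l\le1$ for every $(t_i,t_l)\not\models\Sigma$; $y_{il}\le x_i$ whenever $t_i\in I_C$; $y_{il}\le x_l$ whenever $t_l\in I_C$; $\sum_{t_l\in\overline{M}(t_i)}y_{il}\le k$ for $t_i\in I\setminus I_C$; $\sum_{t_l\in\overline{M}(t_i)}y_{il}\le kx_i$ for $t_i\in I_C$; $x_i\in[0,1]$ ($t_i\in I_C$), $y_{il}\in[0,1]$ ($t_i\in I$,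 $t_l\in\overline{M}(t_i)$).
   Formalization: The weights $L(t_i,t_l)$ and the LP values $x_i$, $y_{il}$ are rational instead of real, so optimality and extreme points are taken among rational feasible solutions. -}

module Defs where

open import Data.Nat as ℕ using (ℕ; suc)
open import Data.Fin as Fin using (Fin)
open import Data.Bool using (Bool; true; false; not; _∧_; T)
open import Data.Maybe using (Maybe; just; nothing)
open import Data.List using (List; []; _∷_; map; filterᵇ; allFin; reverse; foldr; length)
open import Data.Bool.ListAction using (any)
open import Data.Integer using (+_)
open import Data.Rational using (ℚ; 0ℚ; 1ℚ; ½; _+_; _*_; _-_; _≤_; _<_; _≤ᵇ_; _/_)
open import Data.Rational.Properties using (≤-decTotalOrder)
import Data.List.Sort as Sort
open import Data.Product using (_×_)
open import Relation.Binary.PropositionalEquality using (_≡_)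
open import Relation.Nullary using (does)

-- An instance I with n tuples t_0 … t_{n-1}, represented by Fin n.
-- The set Σ of denial constraints enters only through the relation
-- "(t_i , t_l) ⊭ Σ", given as a Boolean matrix V (V i l ≡ true iff the
-- pair (t_i , t_l) violates some constraint of Σ).

Viol : ℕ → Set
Viol n = Fin n → Fin n → Bool

Weight : ℕ → Set
Weight n = Fin n → Fin n → ℚ

inC : ∀ {n} → Viol n → Fin n → Bool
inC {n} V i = any (V i) (allFin n)

_≟ᵇ_ : ∀ {n} → Fin n → Fin n → Bool
i ≟ᵇ j = does (i Fin.≟ j)

cleanOthers : ∀ {n} → Viol n → Fin n → List (Fin n)
cleanOthers {n} V i = filterᵇ (λ l → not (inC V l) ∧ not (l ≟ᵇ i)) (allFin n)

sortedDesc : ∀ {n} → Viol n → Weight n → Fin n → List ℚ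
sortedDesc V L i = reverse (Sort.sort ≤-decTotalOrder (map (L i) (cleanOthers V i)))

-- j-th element (1-based) of a list
nth : {A : Set} → ℕ → List A → Maybe A
nth _             []       = nothing
nth 0             _        = nothing
nth 1             (x ∷ _)  = just x
nth (suc (suc j)) (_ ∷ xs) = nth (suc j) xs

-- L(t_i , t_{l*}) : the k-th largest value of L(t_i , ·) over (I \ I_C) \ {t_i}
-- (nothing if there are fewer than k such tuples)
threshold : ∀ {n} → Viol n → Weight n → ℕ → Fin n → Maybe ℚ
threshold V L k i = nth k (sortedDesc V L i)

inMᵇ : ∀ {n} → Viol n → Weight n → ℕ → Fin n → Fin n → Bool
inMᵇ V L k i r with threshold V L k i
... | just v  = not (r ≟ᵇ i) ∧ (v ≤ᵇ L i r)
... | nothing = false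

inM : ∀ {n} → Viol n → Weight n → ℕ → Fin n → Fin n → Set
inM V L k i r = T (inMᵇ V L k i r)

M̄ : ∀ {n} → Viol n → Weight n → ℕ → Fin n → List (Fin n)
M̄ {n} V L k i = filterᵇ (inMᵇ V L k i) (allFin n)

sumℚ : List ℚ → ℚ
sumℚ = foldr _+_ 0ℚ

ℕtoℚ : ℕ → ℚ
ℕtoℚ m = (+ m) / 1

-- LP solutions.  x i is meaningful only for t_i ∈ I_C and y i l only for
-- t_l ∈ M̄(t_i); other entries are ignored (they are not LP variables).

record Sol (n : ℕ) : Set where
  constructor sol
  field
    x : Fin n → ℚ
    y : Fin n → Fin n → ℚ
open Sol public

rowSum : ∀ {n} → Viol n → Weight n → ℕ → Sol n → Fin n → ℚ
rowSum V L k X i = sumℚ (map (y X i) (M̄ V L k i))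

objective : ∀ {n} → Viol n → Weight n → ℕ → Sol n → ℚ
objective {n} V L k X =
  sumℚ (map (λ i → sumℚ (map (λ l → y X i l * L i l) (M̄ V L k i))) (allFin n))

record Feasible {n} (V : Viol n) (L : Weight n) (k : ℕ) (X : Sol n) : Set where
  field
    conflict : ∀ i l → V i l ≡ true → x X i + x X l ≤ 1ℚ
    y≤xᵢ     : ∀ i l → inM V L k i l → inC V i ≡ true → y X i l ≤ x X i
    y≤xₗ     : ∀ i l → inM V L k i l → inC V l ≡ true → y X i l ≤ x X l
    rowClean : ∀ i → inC V i ≡ false → rowSum V L k X i ≤ ℕtoℚ k
    rowDirty : ∀ i → inC V i ≡ true → rowSum V L k X i ≤ ℕtoℚ k * x X i
    x-lo     : ∀ i → inC V i ≡ true → 0ℚ ≤ x X i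
    x-hi     : ∀ i → inC V i ≡ true → x X i ≤ 1ℚ
    y-lo     : ∀ i l → inM V L k i l → 0ℚ ≤ y X i l
    y-hi     : ∀ i l → inM V L k i l → y X i l ≤ 1ℚ

SameSol : ∀ {n} → Viol n → Weight n → ℕ → Sol n → Sol n → Set
SameSol V L k X Y =
  (∀ i → inC V i ≡ true → x X i ≡ x Y i) ×
  (∀ i l → inM V L k i l → y X i l ≡ y Y i l)

cmb : ℚ → ℚ → ℚ → ℚ
cmb λ′ a b = λ′ * a + (1ℚ - λ′) * b

combSol : ∀ {n} → ℚ → Sol n → Sol n → Sol n
combSol λ′ P Q = sol (λ i → cmb λ′ (x P i) (x Q i)) (λ i l → cmb λ′ (y P i l) (y Q i l))

Optimal : ∀ {n} → Viol n → Weight n → ℕ → Sol n → Set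
Optimal {n} V L k X =
  Feasible V L k X × (∀ (Y : Sol n) → Feasible V L k Y → objective V L k Y ≤ objective V L k X)

ExtremeLP : ∀ {n} → Viol n → Weight n → ℕ → Sol n → Set
ExtremeLP {n} V L k X =
  Feasible V L k X ×
  (∀ (P Q : Sol n) (λ′ : ℚ) → Feasible V L k P → Feasible V L k Q →
     0ℚ < λ′ → λ′ < 1ℚ → SameSol V L k X (combSol λ′ P Q) →
     SameSol V L k P X × SameSol V L k Q X)

InP : ∀ {n} → Viol n → (Fin n → ℚ) → Set
InP V x =
  (∀ i → inC V i ≡ true → 0ℚ ≤ x i) ×
  (∀ i → inC V i ≡ true → x i ≤ 1ℚ) ×
  (∀ i l → V i l ≡ true → x i + x l ≤ 1ℚ)

SameOnIC : ∀ {n} → Viol n → (Fin n → ℚ) → (Fin n → ℚ) → Set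
SameOnIC V x x′ = ∀ i → inC V i ≡ true → x i ≡ x′ i

ExtremeP : ∀ {n} → Viol n → (Fin n → ℚ) → Set
ExtremeP {n} V x =
  InP V x ×
  (∀ (p q : Fin n → ℚ) (λ′ : ℚ) → InP V p → InP V q →
     0ℚ < λ′ → λ′ < 1ℚ → SameOnIC V x (λ i → cmb λ′ (p i) (q i)) →
     SameOnIC V p x × SameOnIC V q x)

𝒳-solution : ∀ {n} → Viol n → Sol n → Set
𝒳-solution V X = ExtremeP V (x X)

HalfIntegral : ℚ → Set
HalfIntegral v = (v ≡ 0ℚ) Data.Sum.⊎ ((v ≡ ½) Data.Sum.⊎ (v ≡ 1ℚ))
  where import Data.Sum

{-# OPTIONS --safe #-}
-- The perturbation φ e t = t + e·t(1 − t)(1 − 2t) drives the proof. For −1 ≤ e ≤ 1 it is a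
-- monotone self-map of [0,1] that fixes 0, ½ and 1 (and, for e ≠ 0, nothing else), satisfies
-- φ e (1 − t) = 1 − φ e t, and φ e, φ (−e) average to the identity.
--
-- Applied with e = ±1 to all of x it preserves P, so extremality of x in P forces
-- φ 1 (x i) = x i, i.e. x i ∈ {0, ½, 1}.
--
-- Now fix a row i and apply φ (e m) to each y i m, m ∈ M̄(t_i). Since the x's are half-integral,
-- y ≤ x is preserved; the row sum moves by Σ e m · c m, where c m = cubic (y i m) is nonzero
-- exactly when y i m ∉ {0, ½, 1}. If the row constraint is slack, a small e supported on one
-- such y i l is admissible with both signs; if it is tight and two entries y i l, y i m are not
-- half-integral, e = c m δ_l − c l δ_m keeps the row sum fixed. Both contradict extremality of
-- X. In a tight row with a single such entry, that entry equals the (half-integral) capacity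
-- minus half-integers, so it is half-integral after all.

module Submission where

open import Defs
open import Data.Fin using (Fin)
open import Data.List using (length)
open import Data.Bool using (true)
open import Data.Product using (_×_; _,_)
open import Relation.Binary.PropositionalEquality using (_≡_)

module HalfIntegrality where

  open import Data.Bool using (false; if_then_else_)
  open import Data.Bool.Properties using (T?; T-≡)
  open import Data.Empty using (⊥-elim)
  import Data.Fin.Properties as Fin
  import Data.Integer as ℤ
  import Data.Integer.Properties as ℤ
  open import Data.List using (List; []; _∷_; map; allFin)
  import Data.List.Properties as List
  open import Data.List.Membership.Propositional using (_∈_; _∉_; lose)
  open import Data.List.Membership.Propositional.Properties using (∈-allFin; ∈-filter⁺; ∈-filter⁻)
  open import Data.List.Relation.Unary.All as All using (All; []; _∷_)
  open import Data.List.Relation.Unary.AllPairs using (_∷_)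
  open import Data.List.Relation.Unary.Any using (here; there)
  open import Data.List.Relation.Unary.Any.Properties using (any⁺)
  open import Data.List.Relation.Unary.Unique.Propositional using (Unique)
  open import Data.List.Relation.Unary.Unique.Propositional.Properties
    using (Unique[x∷xs]⇒x∉xs; allFin⁺; filter⁺)
  open import Data.Nat as ℕ using (ℕ)
  import Data.Nat.Properties as ℕ
  open import Data.Product using (proj₁; proj₂; ∃-syntax)
  -- ℚ's order is opened only inside this module: the statement below uses ℕ's _≤_.
  open import Data.Rational
    using ( ℚ; 0ℚ; 1ℚ; ½; _+_; _*_; _-_; -_; 1/_; _⊓_; _≤_; _<_; _≟_; toℚᵘ
          ; NonZero; nonNegative; nonPositive; ≢-nonZero)
  import Data.Rational.Properties as ℚ
  open import Algebra.Properties.Group ℚ.+-0-group using (identityʳ-unique; x∙y⁻¹≈ε⇒x≈y)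
  open import Data.Rational.Solver using (module +-*-Solver)
  open +-*-Solver using (solve; Polynomial; _:+_; _:*_; _:-_; :-_; con; _:=_)
  open import Data.Rational.Unnormalised as ℚᵘ using (mkℚᵘ; *≡*; *≤*)
  import Data.Rational.Unnormalised.Properties as ℚᵘ
  open import Data.Sum using (_⊎_; inj₁; inj₂; [_,_]′)
  open import Function using (_∘_)
  open import Function.Bundles using (Equivalence)
  open import Relation.Binary.Definitions using (tri<; tri≈; tri>)
  open import Relation.Binary.PropositionalEquality
    using (_≢_; refl; sym; trans; cong; cong₂; subst; subst₂; module ≡-Reasoning)
  open import Relation.Nullary using (yes; no)
  open import Relation.Nullary.Decidable
    using (dec-true; dec-false; from-yes; decidable-stable; ¬?; _×-dec_)

  p≤q⇒0≤q-p : ∀ {p q} → p ≤ q → 0ℚ ≤ q - p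
  p≤q⇒0≤q-p {p} {q} p≤q = subst (_≤ q - p) (ℚ.+-inverseʳ p) (ℚ.+-monoˡ-≤ (- p) p≤q)

  p<q⇒0<q-p : ∀ {p q} → p < q → 0ℚ < q - p
  p<q⇒0<q-p {p} {q} p<q = subst (_< q - p) (ℚ.+-inverseʳ p) (ℚ.+-monoˡ-< (- p) p<q)

  p+[q-p]≡q : ∀ p q → p + (q - p) ≡ q
  p+[q-p]≡q = solve 2 (λ p q → p :+ (q :- p) := q) refl

  ≤-difference⇒+-≤ : ∀ {p q s} → s ≤ q - p → p + s ≤ q
  ≤-difference⇒+-≤ {p} {q} s≤q-p = subst (_ ≤_) (p+[q-p]≡q p q) (ℚ.+-monoʳ-≤ p s≤q-p)

  ≤-by-difference : ∀ {p q d} → q - p ≡ d → 0ℚ ≤ d → p ≤ q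
  ≤-by-difference {p} q-p≡d 0≤d =
    subst (_≤ _) (ℚ.+-identityʳ p) (≤-difference⇒+-≤ (subst (0ℚ ≤_) (sym q-p≡d) 0≤d))

  +-nonNeg : ∀ {p q} → 0ℚ ≤ p → 0ℚ ≤ q → 0ℚ ≤ p + q
  +-nonNeg = ℚ.+-mono-≤

  *-nonNeg : ∀ {p q} → 0ℚ ≤ p → 0ℚ ≤ q → 0ℚ ≤ p * q
  *-nonNeg {p} {q} 0≤p 0≤q =
    ℚ.nonNegative⁻¹ _ {{ℚ.nonNeg*nonNeg⇒nonNeg p {{nonNegative 0≤p}} q {{nonNegative 0≤q}}}}

  square-nonNeg : ∀ p → 0ℚ ≤ p * p
  square-nonNeg p with ℚ.≤-total 0ℚ p
  ... | inj₁ 0≤p = *-nonNeg 0≤p 0≤p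
  -- despite its name, ℚ.nonPos*nonPos⇒nonPos concludes NonNegative
  ... | inj₂ p≤0 =
    ℚ.nonNegative⁻¹ _ {{ℚ.nonPos*nonPos⇒nonPos p {{nonPositive p≤0}} p {{nonPositive p≤0}}}}

  p*q≡0⇒p≡0⊎q≡0 : ∀ {p q} → p * q ≡ 0ℚ → p ≡ 0ℚ ⊎ q ≡ 0ℚ
  p*q≡0⇒p≡0⊎q≡0 {p} {q} pq≡0 with p ≟ 0ℚ
  ... | yes p≡0 = inj₁ p≡0
  ... | no p≢0 = inj₂ (begin
    q                ≡⟨ sym (ℚ.*-identityˡ q) ⟩
    1ℚ * q           ≡⟨ cong (_* q) (sym (ℚ.*-inverseˡ p)) ⟩
    (1/ p * p) * q   ≡⟨ ℚ.*-assoc (1/ p) p q ⟩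
    1/ p * (p * q)   ≡⟨ cong (1/ p *_) pq≡0 ⟩
    1/ p * 0ℚ        ≡⟨ ℚ.*-zeroʳ (1/ p) ⟩
    0ℚ               ∎)
    where
    open ≡-Reasoning
    instance
      p-nonZero : NonZero p
      p-nonZero = ≢-nonZero p≢0

  t≡½[t+t] : ∀ t → t ≡ ½ * (t + t)
  t≡½[t+t] = solve 1 (λ t → t := con ½ :* (t :+ t)) refl

  _∈[0,1] : ℚ → Set
  t ∈[0,1] = 0ℚ ≤ t × t ≤ 1ℚ

  _∈[-1,1] : ℚ → Set
  e ∈[-1,1] = - 1ℚ ≤ e × e ≤ 1ℚ

  0∈[-1,1] : 0ℚ ∈[-1,1]
  0∈[-1,1] = ℚ.≤ᵇ⇒≤ _ , ℚ.≤ᵇ⇒≤ _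

  neg-∈[-1,1] : ∀ {e} → e ∈[-1,1] → (- e) ∈[-1,1]
  neg-∈[-1,1] (-1≤e , e≤1) = ℚ.neg-antimono-≤ e≤1 , ℚ.neg-antimono-≤ -1≤e

  *-∈[-1,1]-≤ : ∀ {ε c} → 0ℚ ≤ ε → c ∈[-1,1] → ε * c ≤ ε
  *-∈[-1,1]-≤ {ε} {c} 0≤ε (_ , c≤1) =
    subst (ε * c ≤_) (ℚ.*-identityʳ ε) (ℚ.*-monoˡ-≤-nonNeg ε {{nonNegative 0≤ε}} c≤1)

  neg-*-∈[-1,1]-≤ : ∀ {ε c} → 0ℚ ≤ ε → c ∈[-1,1] → - (ε * c) ≤ ε
  neg-*-∈[-1,1]-≤ {ε} {c} 0≤ε c∈ =
    subst (_≤ ε) (sym (ℚ.neg-distribʳ-* ε c)) (*-∈[-1,1]-≤ 0≤ε (neg-∈[-1,1] c∈))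

  cubic : ℚ → ℚ
  cubic t = t * ((1ℚ - t) * (1ℚ - (t + t)))

  φ : ℚ → ℚ → ℚ
  φ e t = t + e * cubic t

  cubicᴾ : ∀ {m} → Polynomial m → Polynomial m
  cubicᴾ t = t :* ((con 1ℚ :- t) :* (con 1ℚ :- (t :+ t)))

  φᴾ : ∀ {m} → Polynomial m → Polynomial m → Polynomial m
  φᴾ e t = t :+ e :* cubicᴾ t

  cubic≡0⇒halfIntegral : ∀ {t} → cubic t ≡ 0ℚ → HalfIntegral t
  cubic≡0⇒halfIntegral {t} c≡0 with p*q≡0⇒p≡0⊎q≡0 c≡0
  ... | inj₁ t≡0 = inj₁ t≡0
  ... | inj₂ c≡0′ with p*q≡0⇒p≡0⊎q≡0 c≡0′
  ...   | inj₁ 1-t≡0  = inj₂ (inj₂ (sym (x∙y⁻¹≈ε⇒x≈y 1ℚ t 1-t≡0)))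
  ...   | inj₂ 1-2t≡0 =
    inj₂ (inj₁ (trans (t≡½[t+t] t) (cong (½ *_) (sym (x∙y⁻¹≈ε⇒x≈y 1ℚ (t + t) 1-2t≡0)))))

  halfIntegral⇒cubic≡0 : ∀ {t} → HalfIntegral t → cubic t ≡ 0ℚ
  halfIntegral⇒cubic≡0 (inj₁ refl)        = refl
  halfIntegral⇒cubic≡0 (inj₂ (inj₁ refl)) = refl
  halfIntegral⇒cubic≡0 (inj₂ (inj₂ refl)) = refl

  halfIntegral⇒≤1 : ∀ {t} → HalfIntegral t → t ≤ 1ℚ
  halfIntegral⇒≤1 (inj₁ refl)        = ℚ.≤ᵇ⇒≤ _
  halfIntegral⇒≤1 (inj₂ (inj₁ refl)) = ℚ.≤ᵇ⇒≤ _
  halfIntegral⇒≤1 (inj₂ (inj₂ refl)) = ℚ.≤-refl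

  φ-halfIntegral : ∀ e {t} → HalfIntegral t → φ e t ≡ t
  φ-halfIntegral e {t} h = trans (cong (λ c → t + e * c) (halfIntegral⇒cubic≡0 h)) (t+e*0≡t e t)
    where
    t+e*0≡t : ∀ e t → t + e * 0ℚ ≡ t
    t+e*0≡t = solve 2 (λ e t → t :+ e :* con 0ℚ := t) refl

  φ≡id⇒e*cubic≡0 : ∀ {e t} → φ e t ≡ t → e * cubic t ≡ 0ℚ
  φ≡id⇒e*cubic≡0 {e} {t} = identityʳ-unique t (e * cubic t)

  φ-midpoint : ∀ e t → cmb ½ (φ e t) (φ (- e) t) ≡ t
  φ-midpoint = solve 2 (λ e t → con ½ :* φᴾ e t :+ (con 1ℚ :- con ½) :* φᴾ (:- e) t := t) refl

  cmb-idem : ∀ λ′ t → cmb λ′ t t ≡ t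
  cmb-idem = solve 2 (λ λ′ t → λ′ :* t :+ (con 1ℚ :- λ′) :* t := t) refl

  -- 1 ± (cubic b - cubic a)/(b - a), written so as to be visibly nonnegative on [0,1]²
  slope⁺ slope⁻ : ℚ → ℚ → ℚ
  slope⁺ a b = ½ + ((a + b - 1ℚ) * (a + b - 1ℚ) + ((a - ½) * (a - ½) + (b - ½) * (b - ½)))
  slope⁻ a b = (a + a) * (1ℚ - a) + ((b + b) * (1ℚ - b) + ((1ℚ - a) * b + a * (1ℚ - b)))

  slope⁺ᴾ slope⁻ᴾ : ∀ {m} → Polynomial m → Polynomial m → Polynomial m
  slope⁺ᴾ a b =
    con ½ :+ ((a :+ b :- con 1ℚ) :* (a :+ b :- con 1ℚ)
              :+ ((a :- con ½) :* (a :- con ½) :+ (b :- con ½) :* (b :- con ½)))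
  slope⁻ᴾ a b =
    (a :+ a) :* (con 1ℚ :- a) :+ ((b :+ b) :* (con 1ℚ :- b) :+ ((con 1ℚ :- a) :* b :+ a :* (con 1ℚ :- b)))

  φ-difference : ∀ e a b →
    φ e b - φ e a ≡ (b - a) * ((1ℚ + e) * ½ * slope⁺ a b + (1ℚ - e) * ½ * slope⁻ a b)
  φ-difference = solve 3 (λ e a b → φᴾ e b :- φᴾ e a :=
    (b :- a) :* ((con 1ℚ :+ e) :* con ½ :* slope⁺ᴾ a b :+ (con 1ℚ :- e) :* con ½ :* slope⁻ᴾ a b)) refl

  slope⁺-nonNeg : ∀ a b → 0ℚ ≤ slope⁺ a b
  slope⁺-nonNeg a b = +-nonNeg {½} (ℚ.≤ᵇ⇒≤ _)
    (+-nonNeg (square-nonNeg (a + b - 1ℚ)) (+-nonNeg (square-nonNeg (a - ½)) (square-nonNeg (b - ½))))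

  slope⁻-nonNeg : ∀ {a b} → a ∈[0,1] → b ∈[0,1] → 0ℚ ≤ slope⁻ a b
  slope⁻-nonNeg {a} {b} (0≤a , a≤1) (0≤b , b≤1) =
    +-nonNeg (*-nonNeg (+-nonNeg 0≤a 0≤a) 0≤1-a)
      (+-nonNeg (*-nonNeg (+-nonNeg 0≤b 0≤b) 0≤1-b) (+-nonNeg (*-nonNeg 0≤1-a 0≤b) (*-nonNeg 0≤a 0≤1-b)))
    where
    0≤1-a : 0ℚ ≤ 1ℚ - a
    0≤1-a = p≤q⇒0≤q-p a≤1
    0≤1-b : 0ℚ ≤ 1ℚ - b
    0≤1-b = p≤q⇒0≤q-p b≤1

  φ-mono : ∀ {e a b} → e ∈[-1,1] → 0ℚ ≤ a → a ≤ b → b ≤ 1ℚ → φ e a ≤ φ e b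
  φ-mono {e} {a} {b} (-1≤e , e≤1) 0≤a a≤b b≤1 = ≤-by-difference (φ-difference e a b)
    (*-nonNeg (p≤q⇒0≤q-p a≤b)
      (+-nonNeg (*-nonNeg (*-nonNeg 0≤1+e 0≤½) (slope⁺-nonNeg a b))
                (*-nonNeg (*-nonNeg (p≤q⇒0≤q-p e≤1) 0≤½)
                          (slope⁻-nonNeg (0≤a , ℚ.≤-trans a≤b b≤1) (ℚ.≤-trans 0≤a a≤b , b≤1)))))
    where
    0≤½ : 0ℚ ≤ ½
    0≤½ = ℚ.≤ᵇ⇒≤ _
    0≤1+e : 0ℚ ≤ 1ℚ + e
    0≤1+e = subst (0ℚ ≤_) (ℚ.+-comm e 1ℚ) (ℚ.+-monoˡ-≤ 1ℚ -1≤e)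

  φ-∈[0,1] : ∀ {e t} → e ∈[-1,1] → t ∈[0,1] → φ e t ∈[0,1]
  φ-∈[0,1] {e} {t} e∈ (0≤t , t≤1) =
    subst (_≤ φ e t) (φ-halfIntegral e (inj₁ refl)) (φ-mono e∈ ℚ.≤-refl 0≤t t≤1) ,
    subst (φ e t ≤_) (φ-halfIntegral e (inj₂ (inj₂ refl))) (φ-mono e∈ 0≤t t≤1 ℚ.≤-refl)

  φ-below-halfIntegral : ∀ {e t s} → e ∈[-1,1] → 0ℚ ≤ t → t ≤ s → HalfIntegral s → φ e t ≤ s
  φ-below-halfIntegral {e} {t} e∈ 0≤t t≤s s½ =
    subst (φ e t ≤_) (φ-halfIntegral e s½) (φ-mono e∈ 0≤t t≤s (halfIntegral⇒≤1 s½))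

  φ-conflict : ∀ {e a b} → e ∈[-1,1] → 0ℚ ≤ a → 0ℚ ≤ b → a + b ≤ 1ℚ → φ e a + φ e b ≤ 1ℚ
  φ-conflict {e} {a} {b} e∈ 0≤a 0≤b a+b≤1 =
    ≤-by-difference (reflect e a b) (p≤q⇒0≤q-p (φ-mono e∈ 0≤b b≤1-a 1-a≤1))
    where
    reflect : ∀ e a b → 1ℚ - (φ e a + φ e b) ≡ φ e (1ℚ - a) - φ e b
    reflect = solve 3 (λ e a b → con 1ℚ :- (φᴾ e a :+ φᴾ e b) := φᴾ e (con 1ℚ :- a) :- φᴾ e b) refl
    b≤1-a : b ≤ 1ℚ - a
    b≤1-a = ≤-by-difference (solve 2 (λ a b → (con 1ℚ :- a) :- b := con 1ℚ :- (a :+ b)) refl a b)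
                            (p≤q⇒0≤q-p a+b≤1)
    1-a≤1 : 1ℚ - a ≤ 1ℚ
    1-a≤1 = ≤-by-difference (solve 1 (λ a → con 1ℚ :- (con 1ℚ :- a) := a) refl a) 0≤a

  cubic-∈[-1,1] : ∀ {t} → t ∈[0,1] → cubic t ∈[-1,1]
  cubic-∈[-1,1] {t} t∈ =
    ≤-by-difference (solve 1 (λ t → cubicᴾ t :- :- con 1ℚ := φᴾ (con 1ℚ) t :+ (con 1ℚ :- t)) refl t)
      (+-nonNeg (proj₁ φ₁t∈) (p≤q⇒0≤q-p (proj₂ t∈))) ,
    ≤-by-difference (solve 1 (λ t → con 1ℚ :- cubicᴾ t := (con 1ℚ :- φᴾ (con 1ℚ) t) :+ t) refl t)
      (+-nonNeg (p≤q⇒0≤q-p (proj₂ φ₁t∈)) (proj₁ t∈))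
    where
    φ₁t∈ : φ 1ℚ t ∈[0,1]
    φ₁t∈ = φ-∈[0,1] (ℚ.≤ᵇ⇒≤ _ , ℚ.≤-refl) t∈

  ℕtoℚᵘ : ℕ → ℚᵘ.ℚᵘ
  ℕtoℚᵘ a = mkℚᵘ (ℤ.+ a) 0

  toℚᵘ-ℕtoℚ : ∀ a → toℚᵘ (ℕtoℚ a) ℚᵘ.≃ ℕtoℚᵘ a
  toℚᵘ-ℕtoℚ a = ℚ.toℚᵘ-fromℚᵘ (ℕtoℚᵘ a)

  ℕtoℚᵘ-+ : ∀ a b → ℕtoℚᵘ (a ℕ.+ b) ℚᵘ.≃ ℕtoℚᵘ a ℚᵘ.+ ℕtoℚᵘ b
  ℕtoℚᵘ-+ a b = *≡* (cong (ℤ._* ℤ.+ 1)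
    (trans (ℤ.pos-+ a b) (sym (cong₂ ℤ._+_ (ℤ.*-identityʳ (ℤ.+ a)) (ℤ.*-identityʳ (ℤ.+ b))))))

  ℕtoℚ-+ : ∀ a b → ℕtoℚ (a ℕ.+ b) ≡ ℕtoℚ a + ℕtoℚ b
  ℕtoℚ-+ a b = ℚ.toℚᵘ-injective (begin
    toℚᵘ (ℕtoℚ (a ℕ.+ b))                  ≈⟨ toℚᵘ-ℕtoℚ (a ℕ.+ b) ⟩
    ℕtoℚᵘ (a ℕ.+ b)                        ≈⟨ ℕtoℚᵘ-+ a b ⟩
    ℕtoℚᵘ a ℚᵘ.+ ℕtoℚᵘ b                   ≈⟨ ℚᵘ.+-cong (toℚᵘ-ℕtoℚ a) (toℚᵘ-ℕtoℚ b) ⟨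
    toℚᵘ (ℕtoℚ a) ℚᵘ.+ toℚᵘ (ℕtoℚ b)       ≈⟨ ℚ.toℚᵘ-homo-+ (ℕtoℚ a) (ℕtoℚ b) ⟨
    toℚᵘ (ℕtoℚ a + ℕtoℚ b)                 ∎)
    where open import Relation.Binary.Reasoning.Setoid ℚᵘ.≃-setoid

  ℕtoℚ-cancel-≤ : ∀ {a b} → ℕtoℚ a ≤ ℕtoℚ b → a ℕ.≤ b
  ℕtoℚ-cancel-≤ {a} {b} a≤b
    with ℚᵘ.≤-respˡ-≃ (toℚᵘ-ℕtoℚ a) (ℚᵘ.≤-respʳ-≃ (toℚᵘ-ℕtoℚ b) (ℚ.toℚᵘ-mono-≤ a≤b))
  ... | *≤* a*1≤b*1 = ℤ.drop‿+≤+ (subst₂ ℤ._≤_ (ℤ.*-identityʳ (ℤ.+ a)) (ℤ.*-identityʳ (ℤ.+ b)) a*1≤b*1)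

  _∈½ℕ : ℚ → Set
  q ∈½ℕ = ∃[ a ] q + q ≡ ℕtoℚ a

  ℕtoℚ-∈½ℕ : ∀ a → ℕtoℚ a ∈½ℕ
  ℕtoℚ-∈½ℕ a = a ℕ.+ a , sym (ℕtoℚ-+ a a)

  halfIntegral⇒∈½ℕ : ∀ {t} → HalfIntegral t → t ∈½ℕ
  halfIntegral⇒∈½ℕ (inj₁ refl)        = 0 , refl
  halfIntegral⇒∈½ℕ (inj₂ (inj₁ refl)) = 1 , refl
  halfIntegral⇒∈½ℕ (inj₂ (inj₂ refl)) = 2 , refl

  ∈½ℕ-+ : ∀ {p q} → p ∈½ℕ → q ∈½ℕ → (p + q) ∈½ℕ
  ∈½ℕ-+ {p} {q} (a , 2p≡a) (b , 2q≡b) = a ℕ.+ b , (begin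
    (p + q) + (p + q)    ≡⟨ interchange p q ⟩
    (p + p) + (q + q)    ≡⟨ cong₂ _+_ 2p≡a 2q≡b ⟩
    ℕtoℚ a + ℕtoℚ b      ≡⟨ ℕtoℚ-+ a b ⟨
    ℕtoℚ (a ℕ.+ b)       ∎)
    where
    open ≡-Reasoning
    interchange : ∀ p q → (p + q) + (p + q) ≡ (p + p) + (q + q)
    interchange = solve 2 (λ p q → (p :+ q) :+ (p :+ q) := (p :+ p) :+ (q :+ q)) refl

  ℕtoℚ*halfIntegral-∈½ℕ : ∀ a {t} → HalfIntegral t → (ℕtoℚ a * t) ∈½ℕ
  ℕtoℚ*halfIntegral-∈½ℕ a (inj₁ refl)        = subst _∈½ℕ (sym (ℚ.*-zeroʳ (ℕtoℚ a))) (0 , refl)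
  ℕtoℚ*halfIntegral-∈½ℕ a (inj₂ (inj₁ refl)) =
    a , solve 1 (λ x → x :* con ½ :+ x :* con ½ := x) refl (ℕtoℚ a)
  ℕtoℚ*halfIntegral-∈½ℕ a (inj₂ (inj₂ refl)) = subst _∈½ℕ (sym (ℚ.*-identityʳ (ℕtoℚ a))) (ℕtoℚ-∈½ℕ a)

  ∈½ℕ-cancelʳ : ∀ {p q} → 0ℚ ≤ p → (p + q) ∈½ℕ → q ∈½ℕ → p ∈½ℕ
  ∈½ℕ-cancelʳ {p} {q} 0≤p (a , 2[p+q]≡a) (b , 2q≡b) = a ℕ.∸ b , (begin
    p + p                                ≡⟨ sym (2[p+q]-2q≡2p p q) ⟩
    ((p + q) + (p + q)) - (q + q)        ≡⟨ cong₂ _-_ (trans 2[p+q]≡a (cong ℕtoℚ (sym b+[a∸b]≡a))) 2q≡b ⟩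
    ℕtoℚ (b ℕ.+ (a ℕ.∸ b)) - ℕtoℚ b      ≡⟨ cong (_- ℕtoℚ b) (ℕtoℚ-+ b (a ℕ.∸ b)) ⟩
    (ℕtoℚ b + ℕtoℚ (a ℕ.∸ b)) - ℕtoℚ b   ≡⟨ [x+y]-x≡y (ℕtoℚ b) (ℕtoℚ (a ℕ.∸ b)) ⟩
    ℕtoℚ (a ℕ.∸ b)                       ∎)
    where
    open ≡-Reasoning
    2[p+q]-2q≡2p : ∀ p q → ((p + q) + (p + q)) - (q + q) ≡ p + p
    2[p+q]-2q≡2p = solve 2 (λ p q → ((p :+ q) :+ (p :+ q)) :- (q :+ q) := p :+ p) refl
    [x+y]-x≡y : ∀ x y → (x + y) - x ≡ y
    [x+y]-x≡y = solve 2 (λ x y → (x :+ y) :- x := y) refl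
    b≤a : b ℕ.≤ a
    b≤a = ℕtoℚ-cancel-≤ (subst₂ _≤_ 2q≡b 2[p+q]≡a (≤-by-difference (2[p+q]-2q≡2p p q) (+-nonNeg 0≤p 0≤p)))
    b+[a∸b]≡a : b ℕ.+ (a ℕ.∸ b) ≡ a
    b+[a∸b]≡a = ℕ.m+[n∸m]≡n b≤a

  ∈½ℕ∧≤1⇒halfIntegral : ∀ {t} → t ∈½ℕ → t ≤ 1ℚ → HalfIntegral t
  ∈½ℕ∧≤1⇒halfIntegral {t} (d , t+t≡d) t≤1 =
    subst HalfIntegral (sym (trans (t≡½[t+t] t) (cong (½ *_) t+t≡d))) (halve d d≤2)
    where
    d≤2 : d ℕ.≤ 2
    d≤2 = ℕtoℚ-cancel-≤ (subst (_≤ ℕtoℚ 2) t+t≡d (ℚ.+-mono-≤ t≤1 t≤1))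
    halve : ∀ d → d ℕ.≤ 2 → HalfIntegral (½ * ℕtoℚ d)
    halve 0 _ = inj₁ refl
    halve 1 _ = inj₂ (inj₁ refl)
    halve 2 _ = inj₂ (inj₂ refl)
    halve (ℕ.suc (ℕ.suc (ℕ.suc _))) (ℕ.s≤s (ℕ.s≤s ()))

  sum-∈½ℕ : ∀ {A : Set} {f : A → ℚ} {xs} → All (λ m → f m ∈½ℕ) xs → sumℚ (map f xs) ∈½ℕ
  sum-∈½ℕ []       = 0 , refl
  sum-∈½ℕ {f = f} {x ∷ _} (h ∷ hs) = ∈½ℕ-+ {f x} h (sum-∈½ℕ hs)

  sum-cong : ∀ {A : Set} {f g : A → ℚ} → (∀ m → f m ≡ g m) → ∀ xs → sumℚ (map f xs) ≡ sumℚ (map g xs)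
  sum-cong f≗g xs = cong sumℚ (List.map-cong f≗g xs)

  sum-+ : ∀ {A : Set} (f g : A → ℚ) xs →
          sumℚ (map (λ m → f m + g m) xs) ≡ sumℚ (map f xs) + sumℚ (map g xs)
  sum-+ f g []       = refl
  sum-+ f g (x ∷ xs) = trans (cong ((f x + g x) +_) (sum-+ f g xs)) (interchange (f x) (g x) _ _)
    where
    interchange : ∀ a b c d → (a + b) + (c + d) ≡ (a + c) + (b + d)
    interchange = solve 4 (λ a b c d → (a :+ b) :+ (c :+ d) := (a :+ c) :+ (b :+ d)) refl

  sum-neg : ∀ {A : Set} (f : A → ℚ) xs → sumℚ (map (λ m → - f m) xs) ≡ - sumℚ (map f xs)
  sum-neg f []       = refl
  sum-neg f (x ∷ xs) = trans (cong (- f x +_) (sum-neg f xs)) (sym (ℚ.neg-distrib-+ (f x) _))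

  δ : ∀ {n} → Fin n → Fin n → ℚ
  δ l m = if m ≟ᵇ l then 1ℚ else 0ℚ

  δ-diag : ∀ {n} (l : Fin n) → δ l l ≡ 1ℚ
  δ-diag l rewrite dec-true (l Fin.≟ l) refl = refl

  δ-off : ∀ {n} {l m : Fin n} → m ≢ l → δ l m ≡ 0ℚ
  δ-off {l = l} {m} m≢l rewrite dec-false (m Fin.≟ l) m≢l = refl

  δ-scale-∈[-1,1] : ∀ {n} (l m : Fin n) {a} → a ∈[-1,1] → (δ l m * a) ∈[-1,1]
  δ-scale-∈[-1,1] l m {a} a∈ with m Fin.≟ l
  ... | yes _ = subst _∈[-1,1] (sym (ℚ.*-identityˡ a)) a∈
  ... | no _  = subst _∈[-1,1] (sym (ℚ.*-zeroˡ a)) 0∈[-1,1]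

  δ-pair-∈[-1,1] : ∀ {n} {l m : Fin n} {a b} → m ≢ l → a ∈[-1,1] → b ∈[-1,1] →
                   ∀ j → (δ l j * a + δ m j * b) ∈[-1,1]
  δ-pair-∈[-1,1] {l = l} {m} {a} {b} m≢l a∈ b∈ j with j Fin.≟ l | j Fin.≟ m
  ... | yes j≡l | yes j≡m = ⊥-elim (m≢l (trans (sym j≡m) j≡l))
  ... | yes _   | no _    = subst _∈[-1,1] (sym (1a+0b≡a a b)) a∈
    where
    1a+0b≡a : ∀ a b → 1ℚ * a + 0ℚ * b ≡ a
    1a+0b≡a = solve 2 (λ a b → con 1ℚ :* a :+ con 0ℚ :* b := a) refl
  ... | no _    | yes _   = subst _∈[-1,1] (sym (0a+1b≡b a b)) b∈
    where
    0a+1b≡b : ∀ a b → 0ℚ * a + 1ℚ * b ≡ b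
    0a+1b≡b = solve 2 (λ a b → con 0ℚ :* a :+ con 1ℚ :* b := b) refl
  ... | no _    | no _    = subst _∈[-1,1] (sym (0a+0b≡0 a b)) 0∈[-1,1]
    where
    0a+0b≡0 : ∀ a b → 0ℚ * a + 0ℚ * b ≡ 0ℚ
    0a+0b≡0 = solve 2 (λ a b → con 0ℚ :* a :+ con 0ℚ :* b := con 0ℚ) refl

  sum-δ-∉ : ∀ {n} {l : Fin n} (g : Fin n → ℚ) {xs} → l ∉ xs → sumℚ (map (λ m → δ l m * g m) xs) ≡ 0ℚ
  sum-δ-∉ g {[]}     l∉xs = refl
  sum-δ-∉ g {x ∷ xs} l∉xs =
    cong₂ _+_ (trans (cong (_* g x) (δ-off λ x≡l → l∉xs (here (sym x≡l)))) (ℚ.*-zeroˡ (g x)))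
              (sum-δ-∉ g (l∉xs ∘ there))

  sum-δ : ∀ {n} {l : Fin n} (g : Fin n → ℚ) {xs} → Unique xs → l ∈ xs →
          sumℚ (map (λ m → δ l m * g m) xs) ≡ g l
  sum-δ {l = l} g u (here refl) = trans
    (cong₂ _+_ (trans (cong (_* g l) (δ-diag l)) (ℚ.*-identityˡ (g l))) (sum-δ-∉ g (Unique[x∷xs]⇒x∉xs u)))
    (ℚ.+-identityʳ (g l))
  sum-δ {l = l} g {x ∷ _} (x≢xs ∷ u) (there l∈xs) = trans
    (cong₂ _+_ (trans (cong (_* g x) (δ-off (All.lookup x≢xs l∈xs))) (ℚ.*-zeroˡ (g x))) (sum-δ g u l∈xs))
    (ℚ.+-identityˡ (g l))

  violation⇒inC : ∀ {n} (V : Viol n) {i l} → V i l ≡ true → inC V i ≡ true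
  violation⇒inC V {i} {l} v =
    Equivalence.to T-≡ (any⁺ (V i) (lose (∈-allFin l) (Equivalence.from T-≡ v)))

  φ∘-InP : ∀ {n} (V : Viol n) → (∀ i l → V i l ≡ V l i) →
           ∀ {e x} → e ∈[-1,1] → InP V x → InP V (λ j → φ e (x j))
  φ∘-InP V symmetric e∈ (0≤x , x≤1 , conflict) =
    (λ j j∈C → proj₁ (φ-∈[0,1] e∈ (0≤x j j∈C , x≤1 j j∈C))) ,
    (λ j j∈C → proj₂ (φ-∈[0,1] e∈ (0≤x j j∈C , x≤1 j j∈C))) ,
    (λ i l v → φ-conflict e∈ (0≤x i (violation⇒inC V v))
                             (0≤x l (violation⇒inC V (trans (symmetric l i) v))) (conflict i l v))

  extremeP⇒halfIntegral : ∀ {n} (V : Viol n) → (∀ i l → V i l ≡ V l i) → ∀ {x} → ExtremeP V x →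
                          ∀ i → inC V i ≡ true → HalfIntegral (x i)
  extremeP⇒halfIntegral V symmetric {x} (x∈P , extreme) i i∈C =
    cubic≡0⇒halfIntegral (trans (sym (ℚ.*-identityˡ _)) (φ≡id⇒e*cubic≡0 {1ℚ} (φ₁x≡x i i∈C)))
    where
    φ₁x≡x : SameOnIC V (λ j → φ 1ℚ (x j)) x
    φ₁x≡x = proj₁ (extreme (λ j → φ 1ℚ (x j)) (λ j → φ (- 1ℚ) (x j)) ½
      (φ∘-InP V symmetric (ℚ.≤ᵇ⇒≤ _ , ℚ.≤-refl) x∈P) (φ∘-InP V symmetric (ℚ.≤-refl , ℚ.≤ᵇ⇒≤ _) x∈P)
      (from-yes (0ℚ ℚ.<? ½)) (from-yes (½ ℚ.<? 1ℚ)) (λ j _ → sym (φ-midpoint 1ℚ (x j))))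

  module RowPerturbation {n} (V : Viol n) (L : Weight n) (k : ℕ) (X : Sol n)
                         (extreme : ExtremeLP V L k X)
                         (x-half : ∀ j → inC V j ≡ true → HalfIntegral (x X j)) (i : Fin n) where

    open Feasible (proj₁ extreme)

    capacity : Fin n → ℚ
    capacity j = if inC V j then ℕtoℚ k * x X j else ℕtoℚ k

    rowSum≤capacity : ∀ j → rowSum V L k X j ≤ capacity j
    rowSum≤capacity j with inC V j in j∈C
    ... | true  = rowDirty j j∈C
    ... | false = rowClean j j∈C

    ≤capacity⇒row-constraints : ∀ {j s} → s ≤ capacity j →
      (inC V j ≡ false → s ≤ ℕtoℚ k) × (inC V j ≡ true → s ≤ ℕtoℚ k * x X j)
    ≤capacity⇒row-constraints {j} s≤K with inC V j
    ... | true  = (λ ()) , (λ _ → s≤K)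
    ... | false = (λ _ → s≤K) , (λ ())

    capacity-∈½ℕ : capacity i ∈½ℕ
    capacity-∈½ℕ with inC V i in i∈C
    ... | true  = ℕtoℚ*halfIntegral-∈½ℕ k (x-half i i∈C)
    ... | false = ℕtoℚ-∈½ℕ k

    M : List (Fin n)
    M = M̄ V L k i

    M-unique : Unique M
    M-unique = filter⁺ (T? ∘ inMᵇ V L k i) (allFin⁺ n)

    inM⇒∈M : ∀ {m} → inM V L k i m → m ∈ M
    inM⇒∈M = ∈-filter⁺ (T? ∘ inMᵇ V L k i) (∈-allFin _)

    ∈M⇒inM : ∀ {m} → m ∈ M → inM V L k i m
    ∈M⇒inM m∈M = proj₂ (∈-filter⁻ (T? ∘ inMᵇ V L k i) {xs = allFin n} m∈M)

    S K : ℚ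
    S = rowSum V L k X i
    K = capacity i

    c : Fin n → ℚ
    c m = cubic (y X i m)

    shift : (Fin n → ℚ) → ℚ
    shift e = sumℚ (map (λ m → e m * c m) M)

    shift-neg : ∀ e → shift (λ m → - e m) ≡ - shift e
    shift-neg e =
      trans (sum-cong (λ m → sym (ℚ.neg-distribˡ-* (e m) (c m))) M) (sum-neg (λ m → e m * c m) M)

    perturbed : (Fin n → ℚ) → Sol n
    perturbed e = sol (x X) (λ j m → if j ≟ᵇ i then φ (e m) (y X j m) else y X j m)

    perturbed-y : ∀ (P : ℚ → Set) e {j m} → P (y X j m) → P (φ (e m) (y X j m)) → P (y (perturbed e) j m)
    perturbed-y P e {j} unchanged moved with j Fin.≟ i
    ... | yes _ = moved
    ... | no _  = unchanged

    perturbed-diag : ∀ e m → y (perturbed e) i m ≡ φ (e m) (y X i m)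
    perturbed-diag e m rewrite dec-true (i Fin.≟ i) refl = refl

    perturbed-rowSum≤capacity : ∀ {e} → shift e ≤ K - S → ∀ j → rowSum V L k (perturbed e) j ≤ capacity j
    perturbed-rowSum≤capacity {e} fits j with j Fin.≟ i
    ... | yes refl = subst (_≤ K) (sym (sum-+ (y X i) (λ m → e m * c m) M)) (≤-difference⇒+-≤ fits)
    ... | no _     = rowSum≤capacity j

    perturbed-feasible : ∀ {e} → (∀ m → e m ∈[-1,1]) → shift e ≤ K - S → Feasible V L k (perturbed e)
    perturbed-feasible {e} e∈ fits = record
      { conflict = conflict
      ; y≤xᵢ     = λ j m m∈ j∈C → perturbed-y (_≤ x X j) e (y≤xᵢ j m m∈ j∈C)
                     (φ-below-halfIntegral (e∈ m) (y-lo j m m∈) (y≤xᵢ j m m∈ j∈C) (x-half j j∈C))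
      ; y≤xₗ     = λ j m m∈ m∈C → perturbed-y (_≤ x X m) e (y≤xₗ j m m∈ m∈C)
                     (φ-below-halfIntegral (e∈ m) (y-lo j m m∈) (y≤xₗ j m m∈ m∈C) (x-half m m∈C))
      ; rowClean = λ j → proj₁ (≤capacity⇒row-constraints (perturbed-rowSum≤capacity {e} fits j))
      ; rowDirty = λ j → proj₂ (≤capacity⇒row-constraints (perturbed-rowSum≤capacity {e} fits j))
      ; x-lo     = x-lo
      ; x-hi     = x-hi
      ; y-lo     = λ j m m∈ → perturbed-y (0ℚ ≤_) e (y-lo j m m∈) (proj₁ (y-moved j m m∈))
      ; y-hi     = λ j m m∈ → perturbed-y (_≤ 1ℚ) e (y-hi j m m∈) (proj₂ (y-moved j m m∈))
      }
      where
      y-moved : ∀ j m → inM V L k j m → φ (e m) (y X j m) ∈[0,1]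
      y-moved j m m∈ = φ-∈[0,1] (e∈ m) (y-lo j m m∈ , y-hi j m m∈)

    perturbed-midpoint : ∀ e → SameSol V L k X (combSol ½ (perturbed e) (perturbed (λ m → - e m)))
    perturbed-midpoint e = (λ j _ → sym (cmb-idem ½ (x X j))) , λ j m _ → midpoint j m
      where
      midpoint : ∀ j m → y X j m ≡ cmb ½ (y (perturbed e) j m) (y (perturbed (λ m → - e m)) j m)
      midpoint j m with j Fin.≟ i
      ... | yes _ = sym (φ-midpoint (e m) (y X j m))
      ... | no _  = sym (cmb-idem ½ (y X j m))

    shift-in-slack⇒e*c≡0 : ∀ {e} → (∀ m → e m ∈[-1,1]) → shift e ≤ K - S → - shift e ≤ K - S →
                            ∀ {m} → inM V L k i m → e m * c m ≡ 0ℚ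
    shift-in-slack⇒e*c≡0 {e} e∈ fits₊ fits₋ {m} m∈ =
      φ≡id⇒e*cubic≡0 {e m} (trans (sym (perturbed-diag e m)) (proj₂ unmoved i m m∈))
      where
      unmoved : SameSol V L k (perturbed e) X
      unmoved = proj₁ (proj₂ extreme (perturbed e) (perturbed (λ m → - e m)) ½
        (perturbed-feasible e∈ fits₊)
        (perturbed-feasible (neg-∈[-1,1] ∘ e∈) (subst (_≤ K - S) (sym (shift-neg e)) fits₋))
        (from-yes (0ℚ ℚ.<? ½)) (from-yes (½ ℚ.<? 1ℚ)) (perturbed-midpoint e))

    slack⇒cubic≡0 : S < K → ∀ {l} → inM V L k i l → c l ≡ 0ℚ
    slack⇒cubic≡0 S<K {l} l∈ =
      [ (λ ε≡0 → ⊥-elim (ℚ.<-irrefl (sym ε≡0) 0<ε)) , (λ cl≡0 → cl≡0) ]′ (p*q≡0⇒p≡0⊎q≡0 εcl≡0)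
      where
      ε : ℚ
      ε = 1ℚ ⊓ (K - S)
      0<ε : 0ℚ < ε
      0<ε = [ (λ ε≡1 → subst (0ℚ <_) (sym ε≡1) (from-yes (0ℚ ℚ.<? 1ℚ)))
            , (λ ε≡K-S → subst (0ℚ <_) (sym ε≡K-S) (p<q⇒0<q-p S<K)) ]′ (ℚ.⊓-sel 1ℚ (K - S))
      e : Fin n → ℚ
      e m = δ l m * ε
      e∈ : ∀ m → e m ∈[-1,1]
      e∈ m = δ-scale-∈[-1,1] l m (ℚ.≤-trans (ℚ.≤ᵇ⇒≤ _) (ℚ.<⇒≤ 0<ε) , ℚ.p⊓q≤p 1ℚ (K - S))
      el≡ε : e l ≡ ε
      el≡ε = trans (cong (_* ε) (δ-diag l)) (ℚ.*-identityˡ ε)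
      shift≡εcl : shift e ≡ ε * c l
      shift≡εcl =
        trans (sum-cong (λ m → ℚ.*-assoc (δ l m) ε (c m)) M) (sum-δ (λ m → ε * c m) M-unique (inM⇒∈M l∈))
      fits : ∀ {s} → s ≤ ε → s ≤ K - S
      fits s≤ε = ℚ.≤-trans s≤ε (ℚ.p⊓q≤q 1ℚ (K - S))
      cl∈ : c l ∈[-1,1]
      cl∈ = cubic-∈[-1,1] (y-lo i l l∈ , y-hi i l l∈)
      εcl≡0 : ε * c l ≡ 0ℚ
      εcl≡0 = trans (cong (_* c l) (sym el≡ε)) (shift-in-slack⇒e*c≡0 e∈
        (subst (_≤ K - S) (sym shift≡εcl) (fits (*-∈[-1,1]-≤ (ℚ.<⇒≤ 0<ε) cl∈)))
        (subst (λ s → - s ≤ K - S) (sym shift≡εcl) (fits (neg-*-∈[-1,1]-≤ (ℚ.<⇒≤ 0<ε) cl∈)))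
        l∈)

    tight⇒cubic≡0 : S ≡ K → ∀ {l m} → inM V L k i l → inM V L k i m → m ≢ l → c m ≢ 0ℚ → c l ≡ 0ℚ
    tight⇒cubic≡0 S≡K {l} {m} l∈ m∈ m≢l cm≢0 =
      [ (λ cm≡0 → ⊥-elim (cm≢0 cm≡0)) , (λ cl≡0 → cl≡0) ]′ (p*q≡0⇒p≡0⊎q≡0 cmcl≡0)
      where
      open ≡-Reasoning
      e : Fin n → ℚ
      e j = δ l j * c m + δ m j * (- c l)
      e∈ : ∀ j → e j ∈[-1,1]
      e∈ = δ-pair-∈[-1,1] m≢l (cubic-∈[-1,1] (y-lo i m m∈ , y-hi i m m∈))
                              (neg-∈[-1,1] (cubic-∈[-1,1] (y-lo i l l∈ , y-hi i l l∈)))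
      distrib : ∀ d d′ a b x → (d * a + d′ * b) * x ≡ d * (a * x) + d′ * (b * x)
      distrib = solve 5 (λ d d′ a b x → (d :* a :+ d′ :* b) :* x := d :* (a :* x) :+ d′ :* (b :* x)) refl
      shift≡0 : shift e ≡ 0ℚ
      shift≡0 = begin
        shift e
          ≡⟨ sum-cong (λ j → distrib (δ l j) (δ m j) (c m) (- c l) (c j)) M ⟩
        sumℚ (map (λ j → δ l j * (c m * c j) + δ m j * (- c l * c j)) M)
          ≡⟨ sum-+ (λ j → δ l j * (c m * c j)) (λ j → δ m j * (- c l * c j)) M ⟩
        sumℚ (map (λ j → δ l j * (c m * c j)) M) + sumℚ (map (λ j → δ m j * (- c l * c j)) M)
          ≡⟨ cong₂ _+_ (sum-δ (λ j → c m * c j) M-unique (inM⇒∈M l∈))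
                       (sum-δ (λ j → - c l * c j) M-unique (inM⇒∈M m∈)) ⟩
        c m * c l + - c l * c m
          ≡⟨ solve 2 (λ a b → a :* b :+ :- b :* a := con 0ℚ) refl (c m) (c l) ⟩
        0ℚ ∎
      fits : ∀ {s} → s ≡ 0ℚ → s ≤ K - S
      fits s≡0 = ℚ.≤-reflexive (trans s≡0 (sym (trans (cong (λ s → K - s) S≡K) (ℚ.+-inverseʳ K))))
      el≡cm : e l ≡ c m
      el≡cm = trans (cong₂ (λ d d′ → d * c m + d′ * (- c l)) (δ-diag l) (δ-off (m≢l ∘ sym)))
                    (solve 2 (λ a b → con 1ℚ :* a :+ con 0ℚ :* b := a) refl (c m) (- c l))
      cmcl≡0 : c m * c l ≡ 0ℚ
      cmcl≡0 = trans (cong (_* c l) (sym el≡cm))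
        (shift-in-slack⇒e*c≡0 e∈ (fits shift≡0) (fits (cong -_ shift≡0)) l∈)

    tight⇒halfIntegral : S ≡ K → ∀ {l} → inM V L k i l →
                         (∀ {m} → inM V L k i m → m ≢ l → HalfIntegral (y X i m)) →
                         HalfIntegral (y X i l)
    tight⇒halfIntegral S≡K {l} l∈ others =
      ∈½ℕ∧≤1⇒halfIntegral (∈½ℕ-cancelʳ (y-lo i l l∈) yl+rest-∈½ℕ rest-∈½ℕ) (y-hi i l l∈)
      where
      rest : Fin n → ℚ
      rest j = (1ℚ - δ l j) * y X i j
      split : ∀ d u → u ≡ d * u + (1ℚ - d) * u
      split = solve 2 (λ d u → u := d :* u :+ (con 1ℚ :- d) :* u) refl
      S≡yl+rest : S ≡ y X i l + sumℚ (map rest M)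
      S≡yl+rest = trans (sum-cong (λ j → split (δ l j) (y X i j)) M)
        (trans (sum-+ (λ j → δ l j * y X i j) rest M)
               (cong (_+ sumℚ (map rest M)) (sum-δ (y X i) M-unique (inM⇒∈M l∈))))
      yl+rest-∈½ℕ : (y X i l + sumℚ (map rest M)) ∈½ℕ
      yl+rest-∈½ℕ = subst _∈½ℕ (trans (sym S≡K) S≡yl+rest) capacity-∈½ℕ
      rest-j-∈½ℕ : ∀ {j} → inM V L k i j → rest j ∈½ℕ
      rest-j-∈½ℕ {j} j∈ with j Fin.≟ l
      ... | yes _  = subst _∈½ℕ (sym (solve 1 (λ u → (con 1ℚ :- con 1ℚ) :* u := con 0ℚ) refl (y X i j)))
                       (0 , refl)
      ... | no j≢l = subst _∈½ℕ (sym (solve 1 (λ u → (con 1ℚ :- con 0ℚ) :* u := u) refl (y X i j)))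
                       (halfIntegral⇒∈½ℕ (others j∈ j≢l))
      rest-∈½ℕ : sumℚ (map rest M) ∈½ℕ
      rest-∈½ℕ = sum-∈½ℕ {f = rest} {M} (All.tabulate (rest-j-∈½ℕ ∘ ∈M⇒inM))

    y-halfIntegral : ∀ {l} → inM V L k i l → HalfIntegral (y X i l)
    y-halfIntegral {l} l∈ with ℚ.<-cmp S K
    ... | tri< S<K _ _ = cubic≡0⇒halfIntegral (slack⇒cubic≡0 S<K l∈)
    ... | tri> _ _ K<S = ⊥-elim (ℚ.<-irrefl refl (ℚ.≤-<-trans (rowSum≤capacity i) K<S))
    ... | tri≈ _ S≡K _
      with Fin.any? (λ m → T? (inMᵇ V L k i m) ×-dec ¬? (m Fin.≟ l) ×-dec ¬? (c m ≟ 0ℚ))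
    ...   | yes (m , m∈ , m≢l , cm≢0) = cubic≡0⇒halfIntegral (tight⇒cubic≡0 S≡K l∈ m∈ m≢l cm≢0)
    ...   | no ∄m = tight⇒halfIntegral S≡K l∈ λ {m} m∈ m≢l →
              cubic≡0⇒halfIntegral (decidable-stable (c m ≟ 0ℚ) λ cm≢0 → ∄m (m , m∈ , m≢l , cm≢0))

open HalfIntegrality using (extremeP⇒halfIntegral; module RowPerturbation)
open import Data.Nat using (ℕ; _≤_)

proposition6 :
    (n : ℕ) (V : Viol n) (L : Weight n) (k : ℕ) →
    -- (t_i , t_l) ⊭ Σ is a property of the unordered pair
    (∀ i l → V i l ≡ V l i) →
    1 ≤ k →
    -- t_{l*} exists: (I \ I_C) \ {t_i} has at least k tuples
    (∀ i → k ≤ length (cleanOthers V i)) →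
    (X : Sol n) →
    Optimal V L k X →
    ExtremeLP V L k X →
    𝒳-solution V X →
    (∀ i → inC V i ≡ true → HalfIntegral (x X i)) ×
    (∀ i l → inM V L k i l → HalfIntegral (y X i l))
proposition6 n V L k symmetric _ _ X _ extreme 𝒳 =
  x-half , λ i l → RowPerturbation.y-halfIntegral V L k X extreme x-half i
  where
  x-half : ∀ i → inC V i ≡ true → HalfIntegral (x X i)
  x-half = extremeP⇒halfIntegral V symmetric 𝒳
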